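{- Let $f\colon\{0,1\}^n\to\{0,1,\perp\}$ be a partial function, $F(x,y)=f(x\oplus y)$, and let $h\colon\{0,1\}^n\to\{0,1\}^t$, $\varphi\colon\{0,1\}^t\times\{0,1\}^n\to\{0,1\}$ be total functions with $\varphi(h(x),y)=F(x,y)$ for all $(x,y)\in\operatorname{Dom}(F)$. Let $D$ be the set of good shifts for $h$ and let $\{e_1,\dots,e_k\}$ be a largest linearly independent subset of $D$. Then (i) the cosets of the subspace $\langle e_1,\dots,e_k\rangle$ are exactly the connected components of the total $h$-induced graph, and (ii) for each such coset there is a bijection from the $k$-dimensional Boolean cube $\{0,1\}^k$ onto the coset that is a graph homomorphism from the Boolean cube graph to the total $h$-induced graph.
   Context: $\{0,1\}^n$ is identified with $\mathbb F_2^n$, $\oplus$ is bitwise XOR; $\operatorname{Dom}(f)=f^{ -1}(\{0,1\})$, $\operatorname{Dom}(F)=\{(x,y):x\oplus y\in\operatorname{Dom}(f)\}$. A vector $\Delta$ is a good shift for $h$ if there exist $x,y$ with $x\oplus y=\Delta$ and $h(x)=h(y)$. The total $h$-induced graph has vertex set $\{0,1\}^n$ and an edge between distinct $x,y$ iff $x\oplus y$ is a good shift. The Boolean cube graph on $\{0,1\}^k$ joins two strings iff they differ in exactly one coordinate. -}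

module Defs where

open import Data.Bool using (Bool; true; false; _xor_; if_then_else_)
open import Data.Maybe using (Maybe; just; nothing)
open import Data.Nat using (ℕ; zero; suc)
open import Data.Fin using (Fin; zero; suc)
open import Data.Vec using (Vec; []; _∷_; zipWith; replicate; lookup)
open import Data.Product using (Σ; ∃; _×_; _,_)
open import Relation.Binary.PropositionalEquality using (_≡_; _≢_)
open import Relation.Binary.Construct.Closure.ReflexiveTransitive using (Star)

Bits : ℕ → Set
Bits n = Vec Bool n

_⊕_ : ∀ {n} → Bits n → Bits n → Bits n
_⊕_ = zipWith _xor_

𝟎 : ∀ {n} → Bits n
𝟎 = replicate _ false

lincomb : ∀ {n k} → (Fin k → Bits n) → Bits k → Bits n
lincomb {k = zero}  e []       = 𝟎
lincomb {k = suc k} e (c ∷ cs) = (if c then e zero else 𝟎) ⊕ lincomb (λ i → e (suc i)) cs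

LinIndep : ∀ {n k} → (Fin k → Bits n) → Set
LinIndep {k = k} e = (c : Bits k) → lincomb e c ≡ 𝟎 → c ≡ 𝟎

InSpan : ∀ {n k} → (Fin k → Bits n) → Bits n → Set
InSpan {k = k} e v = Σ (Bits k) λ c → lincomb e c ≡ v

GoodShift : ∀ {n t} → (Bits n → Bits t) → Bits n → Set
GoodShift {n} h Δ = Σ (Bits n) λ x → Σ (Bits n) λ y → (x ⊕ y ≡ Δ) × (h x ≡ h y)

HEdge : ∀ {n t} → (Bits n → Bits t) → Bits n → Bits n → Set
HEdge h x y = (x ≢ y) × GoodShift h (x ⊕ y)

HConnected : ∀ {n t} → (Bits n → Bits t) → Bits n → Bits n → Set
HConnected h = Star (HEdge h)

CubeEdge : ∀ {k} → Bits k → Bits k → Set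
CubeEdge {k} b b' = Σ (Fin k) λ i → (lookup b i ≢ lookup b' i) × (∀ j → j ≢ i → lookup b j ≡ lookup b' j)

-- A maximal independent family e of good shifts spans every good shift, since otherwise it
-- could be extended. Hence each edge of the h-induced graph stays inside a coset of ⟨e⟩, while
-- conversely a ⊕ Σ cᵢeᵢ is reached from a by stepping along the good shifts eᵢ one at a time.
-- The map b ↦ a ⊕ Σ bᵢeᵢ is a bijection onto the coset by independence, and it sends the cube
-- edge flipping bit i to the shift eᵢ.
module Submission where

open import Defs
open import Data.Bool using (Bool; true; false; _xor_; if_then_else_)
open import Data.Bool.Properties using (xor-assoc; xor-comm; xor-identityˡ; xor-identityʳ; xor-same)
  renaming (_≟_ to _≟ᴮ_)
open import Data.Maybe using (Maybe; just)
open import Data.Nat using (ℕ; _≤_; zero; suc)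
open import Data.Nat.Properties using (1+n≰n)
open import Data.Fin using (Fin; zero; suc)
open import Data.Fin.Properties using () renaming (_≟_ to _≟ᶠ_)
open import Data.Fin.Subset.Properties using (anySubset?)
open import Data.Vec using ([]; _∷_; lookup; _[_]≔_)
open import Data.Vec.Properties
  using (≡-dec; zipWith-assoc; zipWith-comm; zipWith-identityˡ; zipWith-identityʳ;
         lookup-zipWith; lookup-replicate; lookup∘update; lookup∘update′)
import Data.Vec.Functional as Vector
open import Data.Vec.Relation.Binary.Pointwise.Extensional using (ext; Pointwise-≡⇒≡)
open import Data.Product using (Σ; _×_; _,_; proj₁)
open import Data.Empty using (⊥-elim)
open import Relation.Nullary using (Dec; yes; no; ¬_)
open import Relation.Binary.PropositionalEquality
open import Relation.Binary.Construct.Closure.ReflexiveTransitive using (ε; _◅_; _◅◅_)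
open import Function.Bundles using (_⇔_; mk⇔)

private
  variable
    n t k : ℕ

⊕-assoc : (x y z : Bits n) → (x ⊕ y) ⊕ z ≡ x ⊕ (y ⊕ z)
⊕-assoc = zipWith-assoc xor-assoc

⊕-comm : (x y : Bits n) → x ⊕ y ≡ y ⊕ x
⊕-comm = zipWith-comm xor-comm

⊕-identityˡ : (x : Bits n) → 𝟎 ⊕ x ≡ x
⊕-identityˡ = zipWith-identityˡ xor-identityˡ

⊕-identityʳ : (x : Bits n) → x ⊕ 𝟎 ≡ x
⊕-identityʳ = zipWith-identityʳ xor-identityʳ

⊕-self : (x : Bits n) → x ⊕ x ≡ 𝟎
⊕-self []      = refl
⊕-self (a ∷ x) = cong₂ _∷_ (xor-same a) (⊕-self x)

⊕-cancelˡ : (x y : Bits n) → x ⊕ (x ⊕ y) ≡ y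
⊕-cancelˡ x y = begin
  x ⊕ (x ⊕ y) ≡⟨ ⊕-assoc x x y ⟨
  (x ⊕ x) ⊕ y ≡⟨ cong (_⊕ y) (⊕-self x) ⟩
  𝟎 ⊕ y       ≡⟨ ⊕-identityˡ y ⟩
  y           ∎
  where open ≡-Reasoning

⊕-injectiveˡ : (x : Bits n) {y z : Bits n} → x ⊕ y ≡ x ⊕ z → y ≡ z
⊕-injectiveˡ x {y} {z} p = trans (sym (⊕-cancelˡ x y)) (trans (cong (x ⊕_) p) (⊕-cancelˡ x z))

⊕≡𝟎⇒≡ : (x y : Bits n) → x ⊕ y ≡ 𝟎 → x ≡ y
⊕≡𝟎⇒≡ x y p = ⊕-injectiveˡ x (trans (⊕-self x) (sym p))

⊕-interchange : (a b c d : Bits n) → (a ⊕ b) ⊕ (c ⊕ d) ≡ (a ⊕ c) ⊕ (b ⊕ d)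
⊕-interchange a b c d = begin
  (a ⊕ b) ⊕ (c ⊕ d) ≡⟨ ⊕-assoc a b (c ⊕ d) ⟩
  a ⊕ (b ⊕ (c ⊕ d)) ≡⟨ cong (a ⊕_) (⊕-assoc b c d) ⟨
  a ⊕ ((b ⊕ c) ⊕ d) ≡⟨ cong (λ u → a ⊕ (u ⊕ d)) (⊕-comm b c) ⟩
  a ⊕ ((c ⊕ b) ⊕ d) ≡⟨ cong (a ⊕_) (⊕-assoc c b d) ⟩
  a ⊕ (c ⊕ (b ⊕ d)) ≡⟨ ⊕-assoc a c (b ⊕ d) ⟨
  (a ⊕ c) ⊕ (b ⊕ d) ∎
  where open ≡-Reasoning

⊕-cancel-common : (a x y : Bits n) → (a ⊕ x) ⊕ (a ⊕ y) ≡ x ⊕ y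
⊕-cancel-common a x y =
  trans (⊕-interchange a x a y) (trans (cong (_⊕ (x ⊕ y)) (⊕-self a)) (⊕-identityˡ (x ⊕ y)))

⊕-telescope : (x y z : Bits n) → (x ⊕ y) ⊕ (y ⊕ z) ≡ x ⊕ z
⊕-telescope x y z = trans (⊕-assoc x y (y ⊕ z)) (cong (x ⊕_) (⊕-cancelˡ y z))

_≟_ : (x y : Bits n) → Dec (x ≡ y)
_≟_ = ≡-dec _≟ᴮ_

scale : Bool → Bits n → Bits n
scale c v = if c then v else 𝟎

scale-xor : (c c' : Bool) (v : Bits n) → scale (c xor c') v ≡ scale c v ⊕ scale c' v
scale-xor true  true  v = sym (⊕-self v)
scale-xor true  false v = sym (⊕-identityʳ v)
scale-xor false c'    v = sym (⊕-identityˡ (scale c' v))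

lincomb-𝟎 : (e : Fin k → Bits n) → lincomb e 𝟎 ≡ 𝟎
lincomb-𝟎 {zero}  e = refl
lincomb-𝟎 {suc k} e = trans (⊕-identityˡ _) (lincomb-𝟎 (Vector.tail e))

lincomb-⊕ : (e : Fin k → Bits n) (b b' : Bits k) → lincomb e (b ⊕ b') ≡ lincomb e b ⊕ lincomb e b'
lincomb-⊕ e [] [] = sym (⊕-identityˡ 𝟎)
lincomb-⊕ e (c ∷ b) (c' ∷ b') =
  trans (cong₂ _⊕_ (scale-xor c c' (e zero)) (lincomb-⊕ (Vector.tail e) b b'))
        (⊕-interchange _ _ _ _)

lincomb-unit : (e : Fin k → Bits n) (i : Fin k) → lincomb e (𝟎 [ i ]≔ true) ≡ e i
lincomb-unit e zero    = trans (cong (e zero ⊕_) (lincomb-𝟎 (Vector.tail e))) (⊕-identityʳ (e zero))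
lincomb-unit e (suc i) = trans (⊕-identityˡ _) (lincomb-unit (Vector.tail e) i)

lincomb-injective : {e : Fin k → Bits n} → LinIndep e →
                    (b b' : Bits k) → lincomb e b ≡ lincomb e b' → b ≡ b'
lincomb-injective {e = e} indep b b' p = ⊕≡𝟎⇒≡ b b' (indep (b ⊕ b') (begin
  lincomb e (b ⊕ b')            ≡⟨ lincomb-⊕ e b b' ⟩
  lincomb e b ⊕ lincomb e b'    ≡⟨ cong (_⊕ lincomb e b') p ⟩
  lincomb e b' ⊕ lincomb e b'   ≡⟨ ⊕-self (lincomb e b') ⟩
  𝟎                             ∎))
  where open ≡-Reasoning

InSpan-𝟎 : (e : Fin k → Bits n) → InSpan e 𝟎
InSpan-𝟎 e = 𝟎 , lincomb-𝟎 e

InSpan-⊕ : {e : Fin k → Bits n} {u v : Bits n} → InSpan e u → InSpan e v → InSpan e (u ⊕ v)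
InSpan-⊕ {e = e} (c , refl) (c' , refl) = c ⊕ c' , lincomb-⊕ e c c'

InSpan? : (e : Fin k → Bits n) (v : Bits n) → Dec (InSpan e v)
InSpan? e v = anySubset? (λ c → lincomb e c ≟ v)

∷-LinIndep : {e : Fin k → Bits n} {d : Bits n} → LinIndep e → ¬ InSpan e d → LinIndep (d Vector.∷ e)
∷-LinIndep {e = e} {d} indep d∉⟨e⟩ (true ∷ c) p = ⊥-elim (d∉⟨e⟩ (c , sym (⊕≡𝟎⇒≡ d (lincomb e c) p)))
∷-LinIndep {e = e} {d} indep d∉⟨e⟩ (false ∷ c) p = cong (false ∷_) (indep c (trans (sym (⊕-identityˡ _)) p))

-- Decidability of span membership (by exhaustive search) makes the extension argument constructive.
maximal⇒spanning : (P : Bits n → Set) (e : Fin k → Bits n) → (∀ i → P (e i)) → LinIndep e →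
                   (∀ k' (e' : Fin k' → Bits n) → (∀ i → P (e' i)) → LinIndep e' → k' ≤ k) →
                   ∀ {d} → P d → InSpan e d
maximal⇒spanning {k = k} P e Pe indep maximal {d} Pd with InSpan? e d
... | yes d∈⟨e⟩ = d∈⟨e⟩
... | no  d∉⟨e⟩ = ⊥-elim (1+n≰n (maximal (suc k) (d Vector.∷ e) P[d∷e] (∷-LinIndep indep d∉⟨e⟩)))
  where
  P[d∷e] : ∀ i → P ((d Vector.∷ e) i)
  P[d∷e] zero    = Pd
  P[d∷e] (suc i) = Pe i

xor-≢ : {x y : Bool} → x ≢ y → x xor y ≡ true
xor-≢ {true}  {true}  x≢y = ⊥-elim (x≢y refl)
xor-≢ {true}  {false} _   = refl
xor-≢ {false} {true}  _   = refl
xor-≢ {false} {false} x≢y = ⊥-elim (x≢y refl)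

CubeEdge⇒⊕≡unit : {b b' : Bits k} ((i , _ , _) : CubeEdge b b') → b ⊕ b' ≡ 𝟎 [ i ]≔ true
CubeEdge⇒⊕≡unit {b = b} {b'} (i , bᵢ≢b'ᵢ , agree) = Pointwise-≡⇒≡ (ext λ j → begin
  lookup (b ⊕ b') j               ≡⟨ lookup-zipWith _xor_ j b b' ⟩
  lookup b j xor lookup b' j      ≡⟨ coordinate j ⟩
  lookup (𝟎 [ i ]≔ true) j        ∎)
  where
  open ≡-Reasoning
  coordinate : ∀ j → lookup b j xor lookup b' j ≡ lookup (𝟎 [ i ]≔ true) j
  coordinate j with j ≟ᶠ i
  ... | yes refl = trans (xor-≢ bᵢ≢b'ᵢ) (sym (lookup∘update i 𝟎 true))
  ... | no  j≢i  = begin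
    lookup b j xor lookup b' j    ≡⟨ cong (_xor lookup b' j) (agree j j≢i) ⟩
    lookup b' j xor lookup b' j   ≡⟨ xor-same (lookup b' j) ⟩
    false                         ≡⟨ lookup-replicate j false ⟨
    lookup 𝟎 j                    ≡⟨ lookup∘update′ j≢i 𝟎 true ⟨
    lookup (𝟎 [ i ]≔ true) j      ∎

CubeEdge⇒≢ : {b b' : Bits k} → CubeEdge b b' → b ≢ b'
CubeEdge⇒≢ (i , bᵢ≢b'ᵢ , _) b≡b' = bᵢ≢b'ᵢ (cong (λ v → lookup v i) b≡b')

module _ (h : Bits n → Bits t) where

  GoodShift-𝟎 : GoodShift h 𝟎
  GoodShift-𝟎 = 𝟎 , 𝟎 , ⊕-self 𝟎 , refl

  GoodShift-scale : (c : Bool) {d : Bits n} → GoodShift h d → GoodShift h (scale c d)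
  GoodShift-scale true  good = good
  GoodShift-scale false _    = GoodShift-𝟎

  GoodShift⇒HConnected : (a : Bits n) {d : Bits n} → GoodShift h d → HConnected h a (a ⊕ d)
  GoodShift⇒HConnected a {d} good with a ≟ (a ⊕ d)
  ... | yes a≡a⊕d = subst (HConnected h a) a≡a⊕d ε
  ... | no  a≢a⊕d = (a≢a⊕d , subst (GoodShift h) (sym (⊕-cancelˡ a d)) good) ◅ ε

  HConnected-lincomb : (e : Fin k → Bits n) → (∀ i → GoodShift h (e i)) →
                       (a : Bits n) (c : Bits k) → HConnected h a (a ⊕ lincomb e c)
  HConnected-lincomb e good a [] = subst (HConnected h a) (sym (⊕-identityʳ a)) ε
  HConnected-lincomb e good a (c ∷ cs) =
    subst (HConnected h a) (⊕-assoc a (scale c (e zero)) _)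
      (GoodShift⇒HConnected a (GoodShift-scale c (good zero))
       ◅◅ HConnected-lincomb (Vector.tail e) (λ i → good (suc i)) (a ⊕ scale c (e zero)) cs)

  HConnected⇒InSpan : {e : Fin k → Bits n} → (∀ {d} → GoodShift h d → InSpan e d) →
                      {a x : Bits n} → HConnected h a x → InSpan e (a ⊕ x)
  HConnected⇒InSpan {e = e} spanning {a} ε = subst (InSpan e) (sym (⊕-self a)) (InSpan-𝟎 e)
  HConnected⇒InSpan {e = e} spanning {a} {x} (_◅_ {j = y} (_ , good) path) =
    subst (InSpan e) (⊕-telescope a y x) (InSpan-⊕ (spanning good) (HConnected⇒InSpan spanning path))

lemma22 : (n t : ℕ) (f : Bits n → Maybe Bool) (h : Bits n → Bits t) (φ : Bits t → Bits n → Bool) →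
          (∀ x y b → f (x ⊕ y) ≡ just b → φ (h x) y ≡ b) →
          (k : ℕ) (e : Fin k → Bits n) →
          (∀ i → GoodShift h (e i)) → LinIndep e →
          (∀ (k' : ℕ) (e' : Fin k' → Bits n) → (∀ i → GoodShift h (e' i)) → LinIndep e' → k' ≤ k) →
          ((a x : Bits n) → HConnected h a x ⇔ InSpan e (a ⊕ x))
          × ((a : Bits n) → Σ (Bits k → Bits n) λ g →
               ((b : Bits k) → InSpan e (a ⊕ g b))
               × ((b b' : Bits k) → g b ≡ g b' → b ≡ b')
               × ((x : Bits n) → InSpan e (a ⊕ x) → Σ (Bits k) λ b → g b ≡ x)
               × ((b b' : Bits k) → CubeEdge b b' → HEdge h (g b) (g b')))
lemma22 n t f h φ _ k e good indep maximal = components , cube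
  where
  spanning : ∀ {d} → GoodShift h d → InSpan e d
  spanning = maximal⇒spanning (GoodShift h) e good indep maximal

  components : (a x : Bits n) → HConnected h a x ⇔ InSpan e (a ⊕ x)
  components a x = mk⇔ (HConnected⇒InSpan h spanning) λ (c , p) →
    subst (HConnected h a) (trans (cong (a ⊕_) p) (⊕-cancelˡ a x)) (HConnected-lincomb h e good a c)

  cube : (a : Bits n) → Σ (Bits k → Bits n) λ g →
           ((b : Bits k) → InSpan e (a ⊕ g b))
           × ((b b' : Bits k) → g b ≡ g b' → b ≡ b')
           × ((x : Bits n) → InSpan e (a ⊕ x) → Σ (Bits k) λ b → g b ≡ x)
           × ((b b' : Bits k) → CubeEdge b b' → HEdge h (g b) (g b'))
  cube a = g , (λ b → b , sym (⊕-cancelˡ a _))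
             , g-injective
             , (λ x (c , p) → c , trans (cong (a ⊕_) p) (⊕-cancelˡ a x))
             , λ b b' edge → (λ gb≡gb' → CubeEdge⇒≢ edge (g-injective b b' gb≡gb'))
                           , subst (GoodShift h) (sym (g-edge b b' edge)) (good (proj₁ edge))
    where
    g : Bits k → Bits n
    g b = a ⊕ lincomb e b

    g-injective : (b b' : Bits k) → g b ≡ g b' → b ≡ b'
    g-injective b b' p = lincomb-injective indep b b' (⊕-injectiveˡ a p)

    g-edge : (b b' : Bits k) ((i , _) : CubeEdge b b') → g b ⊕ g b' ≡ e i
    g-edge b b' edge@(i , _) = begin
      g b ⊕ g b'                    ≡⟨ ⊕-cancel-common a (lincomb e b) (lincomb e b') ⟩
      lincomb e b ⊕ lincomb e b'    ≡⟨ lincomb-⊕ e b b' ⟨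
      lincomb e (b ⊕ b')            ≡⟨ cong (lincomb e) (CubeEdge⇒⊕≡unit edge) ⟩
      lincomb e (𝟎 [ i ]≔ true)     ≡⟨ lincomb-unit e i ⟩
      e i                           ∎
      where open ≡-Reasoning
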